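{- Let $p$ be a Fibonacci prime, i.e. a prime such that there exists a positive integer $a$ with $F_a=p$. Then $S(n)=F_{an+1}$ is an LP function with the prime $p$, and $S(n)=L_{an+1}$ is an LP function with the prime $p$.
   Context: $F_n$ is the Fibonacci sequence ($F_0=0$, $F_1=1$, $F_n=F_{n-1}+F_{n-2}$) and $L_n$ the Lucas numbers ($L_0=2$, $L_1=1$, $L_n=L_{n-1}+L_{n-2}$). An arithmetic function $S$ is an LP function with the prime $p$ if for every nonnegative integer $n=\sum_{i=0}^{r}n_i p^i$ with base-$p$ digits $0\le n_i\le p-1$, one has $S(n)\equiv S(n_0)S(n_1)\cdots S(n_r)\pmod p$. -}

module Defs where

open import Data.Nat using (ℕ; zero; suc; _+_; _*_; NonZero)
open import Data.Nat.DivMod using (_/_; _%_)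
open import Data.List using (List; []; _∷_; map)
open import Data.Nat.ListAction using (product)
open import Relation.Binary.PropositionalEquality using (_≡_)
open import Data.Nat.Primality using (Prime)

fib : ℕ → ℕ
fib 0 = 0
fib 1 = 1
fib (suc (suc n)) = fib (suc n) + fib n

lucas : ℕ → ℕ
lucas 0 = 2
lucas 1 = 1
lucas (suc (suc n)) = lucas (suc n) + lucas n

-- base-p digits (least significant first) of n, using fuel; with fuel ≥ n
-- and p ≥ 2 this is the standard expansion n = Σ n_i p^i, n_r ≠ 0,
-- except that 0 has the single digit 0.
digitsAux : (p : ℕ) → .{{_ : NonZero p}} → ℕ → ℕ → List ℕ
digitsAux p zero    n = []
digitsAux p (suc f) n with n / p
... | zero  = n % p ∷ []
... | suc q = n % p ∷ digitsAux p f (suc q)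

digits : (p : ℕ) → .{{_ : NonZero p}} → ℕ → List ℕ
digits p n = digitsAux p (suc n) n

IsLP : (S : ℕ → ℕ) (p : ℕ) → .{{_ : NonZero p}} → Set
IsLP S p = ∀ (n : ℕ) → S n % p ≡ product (map S (digits p n)) % p

module Submission where

-- Let F_a = p be prime, put c = F_{a+1}.  The proof has three ingredients.
--
-- (1) Multiples of the index.  From the addition formula
--     F_{n+m+1} = F_{n+1} F_{m+1} + F_n F_m  and  F_a ≡ 0 (mod p) one gets
--     F_{an} ≡ 0 and F_{an+1} ≡ c^n (mod p); since L_{k+1} = F_{k+2} + F_k,
--     also L_{an+1} ≡ c^n.  So both functions of the theorem are ≡ c^n.
-- (2) A digit criterion.  If c^K ≡ 1 (mod p) and p ≡ 1 (mod K), then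
--     n ≡ n_0 + n_1 + ⋯ + n_r (mod K), hence c^n ≡ c^{n_0} ⋯ c^{n_r} (mod p):
--     any S with S(n) ≡ c^n (mod p) is an LP function with the prime p.
-- (3) Finding K.  Cassini's identity and F_a ≡ 0, F_{a-1} ≡ c give
--     c² ≡ (-1)^a (mod p).  For p = 2 this forces c odd (K = 1); for odd p
--     and even a, K = 2; for odd p and odd a = 2k+1, K = 4, where p ≡ 1 (mod 4)
--     because p = F_{k+1}² + F_k² is an odd sum of two squares.

open import Defs
open import Data.Nat using (ℕ; zero; suc; _+_; _*_; _^_; _<_; _≤_; s≤s; NonZero; _/_; _%_;
  nonTrivial⇒n>1)
open import Data.Nat.Properties
open import Data.Nat.DivMod
open import Data.Nat.Divisibility using (divides)
open import Data.Nat.Primality using (Prime; prime⇒irreducible; prime⇒nonTrivial)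
open import Data.Nat.ListAction using (sum; product)
open import Data.List using ([]; _∷_; map)
open import Data.Product using (_×_; _,_; ∃; proj₁; proj₂)
open import Data.Sum using (_⊎_; inj₁; inj₂)
open import Data.Empty using (⊥-elim)
open import Relation.Nullary using (¬_; yes; no)
open import Function using (_∘_)
open import Relation.Binary.PropositionalEquality
open import Data.Nat.Tactic.RingSolver using (solve-∀)

fib-add : ∀ n m → fib (suc (n + m)) ≡ fib (suc n) * fib (suc m) + fib n * fib m
fib-add zero m = sym (trans (+-identityʳ _) (*-identityˡ _))
fib-add (suc zero) m = cong₂ _+_ (sym (*-identityˡ (fib (suc m)))) (sym (*-identityˡ (fib m)))
fib-add (suc (suc n)) m = begin
  fib (suc (suc (n + m))) + fib (suc (n + m))
    ≡⟨ cong₂ _+_ (fib-add (suc n) m) (fib-add n m) ⟩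
  (fib (suc (suc n)) * fib (suc m) + fib (suc n) * fib m) + (fib (suc n) * fib (suc m) + fib n * fib m)
    ≡⟨ regroup (fib (suc (suc n))) (fib (suc n)) (fib (suc m)) (fib m) (fib n) ⟩
  (fib (suc (suc n)) + fib (suc n)) * fib (suc m) + (fib (suc n) + fib n) * fib m ∎
  where
  open ≡-Reasoning
  regroup : ∀ A B C D E → (A * C + B * D) + (B * C + E * D) ≡ (A + B) * C + (B + E) * D
  regroup = solve-∀

lucas-fib : ∀ m → lucas (suc m) ≡ fib (suc (suc m)) + fib m
lucas-fib zero = refl
lucas-fib (suc zero) = refl
lucas-fib (suc (suc m)) = trans (cong₂ _+_ (lucas-fib (suc m)) (lucas-fib m))
  (interchange (fib (suc (suc (suc m)))) (fib (suc m)) (fib (suc (suc m))) (fib m))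
  where
  interchange : ∀ A B C D → (A + B) + (C + D) ≡ (A + C) + (B + D)
  interchange = solve-∀

-- One step of Cassini's identity F_{m+2} F_m - F_{m+1}² = (-1)^{m+1}, with
-- the sign moved to whichever side keeps it in ℕ: the two correction terms
-- e and d swap sides when m increases by one.
cassini-step : ∀ m e d → fib (suc (suc m)) * fib m + e ≡ fib (suc m) * fib (suc m) + d →
  fib (suc (suc (suc m))) * fib (suc m) + d ≡ fib (suc (suc m)) * fib (suc (suc m)) + e
cassini-step m e d h = begin
  (A + B) * B + d        ≡⟨ expand A B d ⟩
  A * B + (B * B + d)    ≡⟨ cong (A * B +_) (sym h) ⟩
  A * B + (A * C + e)    ≡⟨ collect A B C e ⟩
  A * (B + C) + e        ∎
  where
  open ≡-Reasoning
  A = fib (suc (suc m))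
  B = fib (suc m)
  C = fib m
  expand : ∀ A B d → (A + B) * B + d ≡ A * B + (B * B + d)
  expand = solve-∀
  collect : ∀ A B C e → A * B + (A * C + e) ≡ A * (B + C) + e
  collect = solve-∀

cassini-even : ∀ k →
  fib (suc (suc (k + k))) * fib (k + k) + 1 ≡ fib (suc (k + k)) * fib (suc (k + k)) + 0
cassini-odd : ∀ k →
  fib (suc (suc (suc (k + k)))) * fib (suc (k + k)) + 0
    ≡ fib (suc (suc (k + k))) * fib (suc (suc (k + k))) + 1
cassini-even zero = refl
cassini-even (suc k) rewrite +-suc k k = cassini-step (suc (k + k)) 0 1 (cassini-odd k)
cassini-odd k = cassini-step (k + k) 1 0 (cassini-even k)

parity : ∀ m → (∃ λ k → m ≡ k + k) ⊎ (∃ λ k → m ≡ suc (k + k))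
parity zero = inj₁ (0 , refl)
parity (suc m) with parity m
... | inj₁ (k , e) = inj₂ (k , cong suc e)
... | inj₂ (k , e) = inj₁ (suc k , cong suc (trans e (sym (+-suc k k))))

module Congruence (k : ℕ) .{{_ : NonZero k}} where

  infix 4 _≈_
  _≈_ : ℕ → ℕ → Set
  x ≈ y = x % k ≡ y % k

  ≡⇒≈ : ∀ {x y} → x ≡ y → x ≈ y
  ≡⇒≈ = cong (_% k)

  +-cong : ∀ {a b c d} → a ≈ b → c ≈ d → a + c ≈ b + d
  +-cong {a} {b} {c} {d} h1 h2 = trans (%-distribˡ-+ a c k)
    (trans (cong₂ (λ u v → (u + v) % k) h1 h2) (sym (%-distribˡ-+ b d k)))

  *-cong : ∀ {a b c d} → a ≈ b → c ≈ d → a * c ≈ b * d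
  *-cong {a} {b} {c} {d} h1 h2 = trans (%-distribˡ-* a c k)
    (trans (cong₂ (λ u v → (u * v) % k) h1 h2) (sym (%-distribˡ-* b d k)))

  ^-cong : ∀ {a b} n → a ≈ b → a ^ n ≈ b ^ n
  ^-cong zero h = refl
  ^-cong (suc n) h = *-cong h (^-cong n h)

  k≈0 : k ≈ 0
  k≈0 = trans (n%n≡0 k) (sym (m*n%n≡0 0 k))

  power-mod-exponent : ∀ c K .{{_ : NonZero K}} → c ^ K ≈ 1 → ∀ x → c ^ x ≈ c ^ (x % K)
  power-mod-exponent c K cᴷ≈1 x = begin
    c ^ x % k                           ≡⟨ ≡⇒≈ (cong (c ^_) (m≡m%n+[m/n]*n x K)) ⟩
    c ^ (x % K + x / K * K) % k         ≡⟨ ≡⇒≈ (^-distribˡ-+-* c (x % K) (x / K * K)) ⟩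
    c ^ (x % K) * c ^ (x / K * K) % k   ≡⟨ *-cong {c ^ (x % K)} refl cycles ⟩
    c ^ (x % K) * 1 % k                 ≡⟨ ≡⇒≈ (*-identityʳ _) ⟩
    c ^ (x % K) % k                     ∎
    where
    open ≡-Reasoning
    cycles : c ^ (x / K * K) ≈ 1
    cycles = trans (≡⇒≈ (trans (cong (c ^_) (*-comm (x / K) K)) (sym (^-*-assoc c K (x / K)))))
      (trans (^-cong (x / K) cᴷ≈1) (≡⇒≈ (^-zeroˡ (x / K))))

  square≈-1⇒fourth-power≈1 : ∀ x → x * x + 1 ≈ 0 → x ^ 4 ≈ 1
  square≈-1⇒fourth-power≈1 x h = begin
    x ^ 4 % k                             ≡⟨ ≡⇒≈ (sym (+-identityʳ _)) ⟩
    (x ^ 4 + 0) % k                       ≡⟨ +-cong {x ^ 4} refl (sym h) ⟩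
    (x ^ 4 + (x * x + 1)) % k             ≡⟨ ≡⇒≈ (factor x) ⟩
    ((x * x) * (x * x + 1) + 1) % k       ≡⟨ +-cong (*-cong {x * x} refl h) refl ⟩
    ((x * x) * 0 + 1) % k                 ≡⟨ ≡⇒≈ (cong (_+ 1) (*-zeroʳ (x * x))) ⟩
    1 % k                                 ∎
    where
    open ≡-Reasoning
    factor : ∀ y → y * (y * (y * (y * 1))) + (y * y + 1) ≡ (y * y) * (y * y + 1) + 1
    factor = solve-∀

  product-cong : (S T : ℕ → ℕ) → (∀ n → S n ≈ T n) →
    ∀ ds → product (map S ds) ≈ product (map T ds)
  product-cong S T h [] = refl
  product-cong S T h (d ∷ ds) = *-cong (h d) (product-cong S T h ds)

square-mod2 : ∀ c → (c * c) % 2 ≡ c % 2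
square-mod2 c = trans (%-distribˡ-* c c 2) (on-residue (m%n<n c 2))
  where
  on-residue : ∀ {r} → r < 2 → (r * r) % 2 ≡ r
  on-residue {0} _ = refl
  on-residue {1} _ = refl
  on-residue {suc (suc _)} (s≤s (s≤s ()))

square≈±1⇒odd : ∀ c → (c * c) % 2 ≡ 1 ⊎ (c * c + 1) % 2 ≡ 0 → c % 2 ≡ 1
square≈±1⇒odd c (inj₁ c²≡1) = trans (sym (square-mod2 c)) c²≡1
square≈±1⇒odd c (inj₂ c²+1≡0) =
  trans (sym (square-mod2 c)) (%-pred-≡0 {c * c} (trans (cong (_% 2) (+-comm 1 (c * c))) c²+1≡0))

prime≢2⇒odd : ∀ {p} → Prime p → ¬ (p ≡ 2) → p % 2 ≡ 1
prime≢2⇒odd {p} pp p≢2 with p % 2 in eq | m%n<n p 2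
... | 1 | _ = refl
... | suc (suc _) | s≤s (s≤s ())
... | 0 | _ with prime⇒irreducible pp
  (divides (p / 2) (trans (m≡m%n+[m/n]*n p 2) (cong (_+ p / 2 * 2) eq)))
...   | inj₁ ()
...   | inj₂ 2≡p = ⊥-elim (p≢2 (sym 2≡p))

square-mod4 : ∀ x → (x * x) % 4 ≡ 0 ⊎ (x * x) % 4 ≡ 1
square-mod4 x = subst (λ t → t ≡ 0 ⊎ t ≡ 1) (sym (%-distribˡ-* x x 4)) (on-residue (m%n<n x 4))
  where
  on-residue : ∀ {r} → r < 4 → (r * r) % 4 ≡ 0 ⊎ (r * r) % 4 ≡ 1
  on-residue {0} _ = inj₁ refl
  on-residue {1} _ = inj₂ refl
  on-residue {2} _ = inj₁ refl
  on-residue {3} _ = inj₂ refl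
  on-residue {suc (suc (suc (suc _)))} (s≤s (s≤s (s≤s (s≤s ()))))

odd-sum-of-squares-mod4 : ∀ x y → (x * x + y * y) % 2 ≡ 1 → (x * x + y * y) % 4 ≡ 1
odd-sum-of-squares-mod4 x y odd =
  trans split (on-residues (square-mod4 x) (square-mod4 y) odd-residue)
  where
  split : (x * x + y * y) % 4 ≡ ((x * x) % 4 + (y * y) % 4) % 4
  split = %-distribˡ-+ (x * x) (y * y) 4
  odd-residue : ((x * x) % 4 + (y * y) % 4) % 4 % 2 ≡ 1
  odd-residue = trans (cong (_% 2) (sym split))
    (trans (m∣n⇒o%n%m≡o%m 2 4 (x * x + y * y) (divides 2 refl)) odd)
  on-residues : ∀ {r s} → r ≡ 0 ⊎ r ≡ 1 → s ≡ 0 ⊎ s ≡ 1 →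
    (r + s) % 4 % 2 ≡ 1 → (r + s) % 4 ≡ 1
  on-residues (inj₁ refl) (inj₂ refl) _ = refl
  on-residues (inj₂ refl) (inj₁ refl) _ = refl
  on-residues (inj₁ refl) (inj₁ refl) ()
  on-residues (inj₂ refl) (inj₂ refl) ()

module DigitSum (p K : ℕ) .{{_ : NonZero p}} .{{_ : NonZero K}}
  (p≥2 : 2 ≤ p) (p≡1 : p % K ≡ 1 % K) where
  open Congruence K

  -- A positive quotient by p is smaller than the dividend; this is what
  -- keeps the fuel of the digit expansion sufficient.
  quotient< : ∀ n {q} → n / p ≡ suc q → suc q < n
  quotient< zero eq with trans (sym (0/n≡0 p)) eq
  ... | ()
  quotient< n@(suc _) eq = subst (_< n) eq (m/n<m n p p≥2)

  -- n = n_0 + p q with q the number formed by the higher digits, and p ≡ 1.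
  digit-sum : ∀ f n → n < f → n ≈ sum (digitsAux p f n)
  digit-sum (suc f) n (s≤s n≤f) with n / p in eq
  ... | zero = ≡⇒≈ division
    where
    division : n ≡ n % p + 0 * p
    division = trans (m≡m%n+[m/n]*n n p) (cong (λ t → n % p + t * p) eq)
  ... | suc q = begin
    n % K                                      ≡⟨ ≡⇒≈ division ⟩
    (n % p + suc q * p) % K                    ≡⟨ +-cong {n % p} refl (*-cong {suc q} refl p≡1) ⟩
    (n % p + suc q * 1) % K                    ≡⟨ ≡⇒≈ (cong (n % p +_) (*-identityʳ (suc q))) ⟩
    (n % p + suc q) % K                        ≡⟨ +-cong {n % p} refl higher-digits ⟩
    (n % p + sum (digitsAux p f (suc q))) % K  ∎
    where
    open ≡-Reasoning
    division : n ≡ n % p + suc q * p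
    division = trans (m≡m%n+[m/n]*n n p) (cong (λ t → n % p + t * p) eq)
    higher-digits : suc q ≈ sum (digitsAux p f (suc q))
    higher-digits = digit-sum f (suc q) (≤-trans (quotient< n eq) n≤f)

power-of-sum : ∀ c ds → c ^ sum ds ≡ product (map (c ^_) ds)
power-of-sum c [] = refl
power-of-sum c (d ∷ ds) =
  trans (^-distribˡ-+-* c d (sum ds)) (cong (c ^ d *_) (power-of-sum c ds))

record DigitExponent (p c : ℕ) .{{_ : NonZero p}} : Set where
  field
    K : ℕ
    .{{K≢0}} : NonZero K
    p≡1-mod-K : p % K ≡ 1 % K
    cᴷ≡1-mod-p : c ^ K % p ≡ 1 % p

geometric⇒LP : ∀ {p c} .{{_ : NonZero p}} → 2 ≤ p → DigitExponent p c →
  (S : ℕ → ℕ) → (∀ n → S n % p ≡ c ^ n % p) → IsLP S p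
geometric⇒LP {p} {c} p≥2 e S S≈cⁿ n = begin
  S n % p                           ≡⟨ S≈cⁿ n ⟩
  c ^ n % p                         ≡⟨ power-mod-exponent c K cᴷ≡1-mod-p n ⟩
  c ^ (n % K) % p                   ≡⟨ cong (λ t → c ^ t % p) (digit-sum (suc n) n ≤-refl) ⟩
  c ^ (sum ds % K) % p              ≡⟨ power-mod-exponent c K cᴷ≡1-mod-p (sum ds) ⟨
  c ^ sum ds % p                    ≡⟨ ≡⇒≈ (power-of-sum c ds) ⟩
  product (map (c ^_) ds) % p       ≡⟨ product-cong (c ^_) S (λ m → sym (S≈cⁿ m)) ds ⟩
  product (map S ds) % p            ∎
  where
  open ≡-Reasoning
  open DigitExponent e
  open Congruence p
  open DigitSum p K p≥2 p≡1-mod-K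
  ds = digits p n

module FibonacciMultiples (p m : ℕ) .{{_ : NonZero p}}
  (F≈0 : Congruence._≈_ p (fib (suc m)) 0) where
  open Congruence p

  a c : ℕ
  a = suc m
  c = fib (suc a)

  fib-multiples : ∀ n → (fib (a * n) ≈ 0) × (fib (suc (a * n)) ≈ c ^ n)
  fib-multiples zero rewrite *-zeroʳ a = refl , refl
  fib-multiples (suc n) = next-zero , next-power
    where
    zero-n = proj₁ (fib-multiples n)
    power-n = proj₂ (fib-multiples n)
    next-zero : fib (a * suc n) ≈ 0
    next-zero = begin
      fib (a * suc n) % p
        ≡⟨ ≡⇒≈ (cong fib (trans (*-suc a n) (cong suc (+-comm m (a * n))))) ⟩
      fib (suc (a * n + m)) % p
        ≡⟨ ≡⇒≈ (fib-add (a * n) m) ⟩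
      (fib (suc (a * n)) * fib a + fib (a * n) * fib m) % p
        ≡⟨ +-cong (*-cong power-n F≈0) (*-cong {c = fib m} zero-n refl) ⟩
      (c ^ n * 0 + 0 * fib m) % p
        ≡⟨ ≡⇒≈ (trans (+-identityʳ _) (*-zeroʳ (c ^ n))) ⟩
      0 % p ∎
      where open ≡-Reasoning
    next-power : fib (suc (a * suc n)) ≈ c ^ suc n
    next-power = begin
      fib (suc (a * suc n)) % p
        ≡⟨ ≡⇒≈ (cong fib (cong suc (trans (*-suc a n) (+-comm a (a * n))))) ⟩
      fib (suc (a * n + a)) % p
        ≡⟨ ≡⇒≈ (fib-add (a * n) a) ⟩
      (fib (suc (a * n)) * c + fib (a * n) * fib a) % p
        ≡⟨ +-cong (*-cong {c = c} power-n refl) (*-cong {c = fib a} zero-n refl) ⟩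
      (c ^ n * c + 0 * fib a) % p
        ≡⟨ ≡⇒≈ (trans (+-identityʳ _) (*-comm (c ^ n) c)) ⟩
      c ^ suc n % p ∎
      where open ≡-Reasoning

  fib-geometric : ∀ n → fib (a * n + 1) ≈ c ^ n
  fib-geometric n = trans (≡⇒≈ (cong fib (+-comm (a * n) 1))) (proj₂ (fib-multiples n))

  lucas-geometric : ∀ n → lucas (a * n + 1) ≈ c ^ n
  lucas-geometric n = begin
    lucas (a * n + 1) % p
      ≡⟨ ≡⇒≈ (trans (cong lucas (+-comm (a * n) 1)) (lucas-fib (a * n))) ⟩
    (fib (suc (a * n)) + fib (a * n) + fib (a * n)) % p
      ≡⟨ +-cong (+-cong power-n zero-n) zero-n ⟩
    (c ^ n + 0 + 0) % p
      ≡⟨ ≡⇒≈ (trans (+-identityʳ _) (+-identityʳ _)) ⟩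
    c ^ n % p ∎
    where
    open ≡-Reasoning
    zero-n = proj₁ (fib-multiples n)
    power-n = proj₂ (fib-multiples n)

  -- F_{a-1} = F_{a+1} - F_a ≡ c.
  predecessor≈c : fib m ≈ c
  predecessor≈c = sym (+-cong {fib a} {0} {fib m} F≈0 refl)

  -- Cassini's identity at index a - 1 reduces modulo p to c² + e ≡ d.
  cassini⇒square : ∀ e d → c * fib m + e ≡ fib a * fib a + d → c * c + e ≈ d
  cassini⇒square e d h = begin
    (c * c + e) % p            ≡⟨ +-cong {c = e} (*-cong {c} refl (sym predecessor≈c)) refl ⟩
    (c * fib m + e) % p        ≡⟨ ≡⇒≈ h ⟩
    (fib a * fib a + d) % p    ≡⟨ +-cong (*-cong F≈0 F≈0) refl ⟩
    d % p                      ∎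
    where open ≡-Reasoning

  square-odd-index : ∀ k → m ≡ k + k → c * c + 1 ≈ 0
  square-odd-index k refl = cassini⇒square 1 0 (cassini-even k)

  square-even-index : ∀ k → m ≡ suc (k + k) → c * c ≈ 1
  square-even-index k refl =
    trans (≡⇒≈ (sym (+-identityʳ (c * c)))) (cassini⇒square 0 1 (cassini-odd k))

fib≈0 : ∀ p m .{{_ : NonZero p}} → fib (suc m) ≡ p → Congruence._≈_ p (fib (suc m)) 0
fib≈0 p m F≡p = trans (cong (_% p) F≡p) (Congruence.k≈0 p)

fibonacci-prime-digit-exponent : ∀ p m .{{_ : NonZero p}} → Prime p → fib (suc m) ≡ p →
  DigitExponent p (fib (suc (suc m)))
fibonacci-prime-digit-exponent p m pp F≡p with p ≟ 2 | parity m
... | yes refl | m-parity = record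
  { K = 1 ; p≡1-mod-K = refl
  ; cᴷ≡1-mod-p = trans (cong (_% 2) (*-identityʳ c)) (square≈±1⇒odd c (square≈±1 m-parity)) }
  where
  open FibonacciMultiples 2 m (fib≈0 2 m F≡p)
  square≈±1 : (∃ λ k → m ≡ k + k) ⊎ (∃ λ k → m ≡ suc (k + k)) →
    (c * c) % 2 ≡ 1 ⊎ (c * c + 1) % 2 ≡ 0
  square≈±1 (inj₁ (k , m-even)) = inj₂ (square-odd-index k m-even)
  square≈±1 (inj₂ (k , m-odd)) = inj₁ (square-even-index k m-odd)
... | no p≢2 | inj₂ (k , m-odd) = record
  { K = 2 ; p≡1-mod-K = prime≢2⇒odd pp p≢2
  ; cᴷ≡1-mod-p = trans (cong (λ t → c * t % p) (*-identityʳ c)) (square-even-index k m-odd) }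
  where open FibonacciMultiples p m (fib≈0 p m F≡p)
... | no p≢2 | inj₁ (k , m-even) = record
  { K = 4 ; p≡1-mod-K = p≡1-mod-4
  ; cᴷ≡1-mod-p = Congruence.square≈-1⇒fourth-power≈1 p c (square-odd-index k m-even) }
  where
  open FibonacciMultiples p m (fib≈0 p m F≡p)
  -- p = F_{2k+1} = F_{k+1}² + F_k² is an odd sum of two squares.
  two-squares : p ≡ fib (suc k) * fib (suc k) + fib k * fib k
  two-squares = trans (sym F≡p) (trans (cong (fib ∘ suc) m-even) (fib-add k k))
  p≡1-mod-4 : p % 4 ≡ 1
  p≡1-mod-4 = subst (λ t → t % 4 ≡ 1) (sym two-squares)
    (odd-sum-of-squares-mod4 (fib (suc k)) (fib k)
      (subst (λ t → t % 2 ≡ 1) two-squares (prime≢2⇒odd pp p≢2)))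

corollary3 : ∀ (p a : ℕ) .{{_ : NonZero p}} → Prime p → 0 < a → fib a ≡ p →
    IsLP (λ n → fib (a * n + 1)) p × IsLP (λ n → lucas (a * n + 1)) p
corollary3 p zero _ () _
corollary3 p (suc m) pp _ F≡p =
  geometric⇒LP p≥2 exponent _ fib-geometric , geometric⇒LP p≥2 exponent _ lucas-geometric
  where
  open FibonacciMultiples p m (fib≈0 p m F≡p)
  p≥2 : 2 ≤ p
  p≥2 = nonTrivial⇒n>1 p {{prime⇒nonTrivial pp}}
  exponent : DigitExponent p c
  exponent = fibonacci-prime-digit-exponent p m pp F≡p
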